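{- Let $P$ be a not-free, constraint-free and head-consistent NNP program, and let $\mathrm{Cn}(X)$ denote the smallest interpretation closed under a program $X$. Then: (4) $\mathrm{Cn}(P)=\mathrm{Cn}(\mathrm{NN}(P))$; (5) $NT_P(I)=T_{\mathrm{NN}(P)}(I)$ for every interpretation $I$; (6) $P$ and $\mathrm{NN}(P)$ are strongly equivalent.
   Context: Atoms $\mathcal{A}$; literals $\mathcal{L}=\mathcal{A}\cup\{\neg a:a\in\mathcal{A}\}$; default literals $\mathit{not}\,\ell$; elementary expressions $\mathcal{E}^1=\mathcal{L}\cup\{\mathit{not}\,\ell\}\cup\{\top,\bot\}$; overlined elementary expressions $\overline{x}$ ($x\in\mathcal{E}^1$). Expressions are built with $\bigwedge[\ldots]$, $\bigvee(\ldots)$; body expressions contain no overlines; an expression is not-free if it contains no default literal (plain or overlined). Interpretation: $I\subseteq\mathcal{L}$ with no pair $a,\neg a$; $I\models\top$, $I\not\models\bot$, $I\models\ell$ iff $\ell\in I$, $I\models\mathit{not}\,\ell$ iff $\ell\notin I$, $I\models\overline{x}$ iff $I\not\models x$, connectives as usual; $I=\!\!\!|\,\varphi$ iff $I\not\models\varphi$. Reduct: $x^I=x$ for $x\in\mathcal{L}\cup\{\top,\bot\}$, $(\mathit{not}\,\ell)^I=\bot$ if $\ell\in I$ else $\top$, $(\overline{x})^I=\overline{x^I}$, commuting with connectives. Positive elements: $\mathcal{L}\cup\{\bot\}$. $\mathcal{N}$: expressions in which every elementary occurrence is overlined. $\mathcal{H}^+$: smallest set containing $\mathcal{L}\cup\{\bot\}$,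 closed under $\bigwedge$ of members, and containing $\bigvee(\varphi_1\ldots\varphi_k)$ whenever one $\varphi_i\in\mathcal{H}^+$ and all other $\varphi_j\in\mathcal{N}$. For $H\in\mathcal{H}^+$ and a positive occurrence $h$, $\Delta(H,h)$ is $\bot$ if $H$ is that occurrence, $\Delta(H_i,h)$ if $H=\bigwedge[H_1\ldots H_k]$ with the occurrence in $H_i$, $\bigvee(H_1\ldots\Delta(H_i,h)\ldots H_k)$ if $H=\bigvee(H_1\ldots H_k)$ with the occurrence in $H_i$. $H_\Delta=\bigwedge[\bigvee(h_1\,\Delta(H,h_1))\ldots\bigvee(h_k\,\Delta(H,h_k))]$ over all positive occurrences. An NNP program is a finite nonempty set of rules $H\leftarrow B$, $B$ a body expression, $H\in\mathcal{H}^+$. It is not-free if all $B$ and $H$ are not-free; constraint-free if no head has a positive occurrence of $\bot$; head-consistent if its positive head occurrences $h\neq\bot$ contain no pair $a,\neg a$. $I$ is closed under $P$ if for every rule and conjunct $\bigvee(h\,\Delta)$ of $H_\Delta$: $h\in I$ whenever $I\models B$ and $I=\!\!\!|\,\Delta$. $NT_P(I)=\{h: (H\leftarrow B)\in P,\ \bigvee(h\,\Delta)\text{ conjunct of }H_\Delta,\ I\models B,\ I=\!\!\!|\,\Delta\}$. Dual $\Delta_B$: exchange $\bigwedge/\bigvee$, replace $\overline{x}$ by $x$, plain $\bot$ by $\top$ (so $I\models\Delta_B$ iff $I=\!\!\!|\,\Delta$). $\mathrm{NN}(P)=\bigcup_{(H\leftarrow B)\in P}\{h\leftarrow C:\bigvee(h\,\Delta)\text{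 conjunct of }H_\Delta,\ C\text{ disjunct of the DNF of }\bigwedge[B\ \Delta_B]\text{ obtained by distributivity}\}$. For a program $Q$ of rules $h\leftarrow C$ ($C$ a conjunction of elementary expressions): $I$ is closed under $Q$ if $h\in I$ whenever $I\models C$; $T_Q(I)=\{h:(h\leftarrow C)\in Q,\ I\models C\}$. Strong equivalence: a nested rule is $F\leftarrow G$ ($F,G$ expressions); $P^I=\{F^I\leftarrow G^I\}$; $I$ closed under $P^I$ if $I\models F^I$ whenever $I\models G^I$; $I$ is an answer set of a nested program $P$ if it is $\subseteq$-minimal among interpretations closed under $P^I$; $P_1,P_2$ are strongly equivalent if for every nested program $Q$, $P_1\cup Q$ and $P_2\cup Q$ have the same answer sets. -}

module Defs where

open import Data.Bool using (Bool; true; false; not; _∧_; _∨_)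
open import Data.List using (List; []; _∷_; _++_; map; concatMap)
open import Data.List.Relation.Unary.All using (All)
open import Data.List.Membership.Propositional using (_∈_)
open import Data.Product using (_×_; _,_; ∃; ∃-syntax)
open import Data.Empty using (⊥)
open import Relation.Binary.PropositionalEquality using (_≡_)
open import Relation.Nullary using (¬_)
open import Function.Bundles using (_⇔_)

data Lit (A : Set) : Set where
  pos : A → Lit A
  neg : A → Lit A

data Elem (A : Set) : Set where
  lit : Lit A → Elem A
  nt  : Lit A → Elem A
  ⊤e  : Elem A
  ⊥e  : Elem A

data Expr (A : Set) : Set where
  el : Elem A → Expr A
  ov : Elem A → Expr A      -- overlined elementary expression  x̄
  ⋀  : List (Expr A) → Expr A
  ⋁  : List (Expr A) → Expr A

-- Interpretations: consistent sets of literals (as characteristic functions)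

record Interp (A : Set) : Set where
  field
    val        : Lit A → Bool
    consistent : ∀ a → val (pos a) ≡ true → val (neg a) ≡ true → ⊥
open Interp public

_⊆I_ : {A : Set} → Interp A → Interp A → Set
I ⊆I J = ∀ l → val I l ≡ true → val J l ≡ true

module _ {A : Set} where

  satE : Interp A → Elem A → Bool
  satE I (lit l) = val I l
  satE I (nt l)  = not (val I l)
  satE I ⊤e      = true
  satE I ⊥e      = false

  -- sat I φ ≡ true  is  I ⊨ φ ;  sat I φ ≡ false  is  I =| φ
  mutual
    sat : Interp A → Expr A → Bool
    sat I (el x) = satE I x
    sat I (ov x) = not (satE I x)
    sat I (⋀ es) = satAll I es
    sat I (⋁ es) = satAny I es

    satAll : Interp A → List (Expr A) → Bool
    satAll I []       = true
    satAll I (e ∷ es) = sat I e ∧ satAll I es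

    satAny : Interp A → List (Expr A) → Bool
    satAny I []       = false
    satAny I (e ∷ es) = sat I e ∨ satAny I es

  reductE : Interp A → Elem A → Elem A
  reductE I (nt l) with val I l
  ... | true  = ⊥e
  ... | false = ⊤e
  reductE I x = x

  mutual
    reduct : Interp A → Expr A → Expr A
    reduct I (el x) = el (reductE I x)
    reduct I (ov x) = ov (reductE I x)
    reduct I (⋀ es) = ⋀ (reductL I es)
    reduct I (⋁ es) = ⋁ (reductL I es)

    reductL : Interp A → List (Expr A) → List (Expr A)
    reductL I []       = []
    reductL I (e ∷ es) = reduct I e ∷ reductL I es

  data Body : Expr A → Set where
    el : ∀ x → Body (el x)
    ⋀  : ∀ {es} → All Body es → Body (⋀ es)
    ⋁  : ∀ {es} → All Body es → Body (⋁ es)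

  data NotFreeE : Elem A → Set where
    lit : ∀ l → NotFreeE (lit l)
    ⊤e  : NotFreeE ⊤e
    ⊥e  : NotFreeE ⊥e

  data NotFree : Expr A → Set where
    el : ∀ {x} → NotFreeE x → NotFree (el x)
    ov : ∀ {x} → NotFreeE x → NotFree (ov x)
    ⋀  : ∀ {es} → All NotFree es → NotFree (⋀ es)
    ⋁  : ∀ {es} → All NotFree es → NotFree (⋁ es)

  data InN : Expr A → Set where
    ov : ∀ x → InN (ov x)
    ⋀  : ∀ {es} → All InN es → InN (⋀ es)
    ⋁  : ∀ {es} → All InN es → InN (⋁ es)

  data InH+ : Expr A → Set where
    lit : ∀ l → InH+ (el (lit l))
    ⊥e  : InH+ (el ⊥e)
    ⋀   : ∀ {es} → All InH+ es → InH+ (⋀ es)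
    ⋁   : ∀ {pre post e} → All InN pre → InH+ e → All InN post
          → InH+ (⋁ (pre ++ e ∷ post))

  -- Positive occurrences h of H together with Δ(H,h).
  -- Positive occurrences of H ∈ ℋ⁺ are exactly its non-overlined
  -- elementary occurrences; the list H_Δ-conjuncts enumerates them.

  mutual
    occs : Expr A → List (Elem A × Expr A)
    occs (el x) = (x , el ⊥e) ∷ []
    occs (ov x) = []
    occs (⋀ es) = occsAnd es
    occs (⋁ es) = occsOr [] es

    occsAnd : List (Expr A) → List (Elem A × Expr A)
    occsAnd []       = []
    occsAnd (e ∷ es) = occs e ++ occsAnd es

    -- occsOr pre es : occurrences inside es, where the disjunction is ⋁(pre ++ es)
    occsOr : List (Expr A) → List (Expr A) → List (Elem A × Expr A)
    occsOr pre []       = []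
    occsOr pre (e ∷ es) =
      map (λ { (h , d) → (h , ⋁ (pre ++ d ∷ es)) }) (occs e)
      ++ occsOr (pre ++ e ∷ []) es

  -- dual Δ_B : exchange ⋀/⋁, x̄ ↦ x, plain ⊥ ↦ ⊤
  -- (plain elementary x ≠ ⊥ cannot occur in a Δ; it is mapped to x̄ so that
  --  I ⊨ Δ_B iff I =| Δ holds in general)
  mutual
    dual : Expr A → Expr A
    dual (el ⊥e)      = el ⊤e
    dual (el ⊤e)      = ov ⊤e
    dual (el (lit l)) = ov (lit l)
    dual (el (nt l))  = ov (nt l)
    dual (ov x)       = el x
    dual (⋀ es)       = ⋁ (dualL es)
    dual (⋁ es)       = ⋀ (dualL es)

    dualL : List (Expr A) → List (Expr A)
    dualL []       = []
    dualL (e ∷ es) = dual e ∷ dualL es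

  -- DNF by distributivity: list of disjuncts, each a list of conjuncts
  cross : List (List (Expr A)) → List (List (Expr A)) → List (List (Expr A))
  cross cs ds = concatMap (λ c → map (c ++_) ds) cs

  mutual
    dnf : Expr A → List (List (Expr A))
    dnf (el x) = (el x ∷ []) ∷ []
    dnf (ov x) = (ov x ∷ []) ∷ []
    dnf (⋀ es) = dnfAnd es
    dnf (⋁ es) = dnfOr es

    dnfAnd : List (Expr A) → List (List (Expr A))
    dnfAnd []       = [] ∷ []
    dnfAnd (e ∷ es) = cross (dnf e) (dnfAnd es)

    dnfOr : List (Expr A) → List (List (Expr A))
    dnfOr []       = []
    dnfOr (e ∷ es) = dnf e ++ dnfOr es

record Rule (A : Set) : Set where
  constructor _⇐_
  field
    head : Expr A
    body : Expr A
open Rule public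

-- a program is a finite list of rules (read as the set of its elements)
Program : Set → Set
Program A = List (Rule A)

-- simple rules h ← C, C a conjunction (list) of elementary expressions
record SRule (A : Set) : Set where
  constructor _←s_
  field
    hd : Elem A
    bd : List (Expr A)
open SRule public

SProgram : Set → Set
SProgram A = List (SRule A)

record NRule (A : Set) : Set where
  constructor _←n_
  field
    nhead : Expr A
    nbody : Expr A
open NRule public

NProgram : Set → Set
NProgram A = List (NRule A)

module _ {A : Set} where

  IsNNP : Program A → Set
  IsNNP P = ¬ (P ≡ []) × (∀ {r} → r ∈ P → Body (body r) × InH+ (head r))

  NotFreeP : Program A → Set
  NotFreeP P = ∀ {r} → r ∈ P → NotFree (body r) × NotFree (head r)

  ConstraintFree : Program A → Set
  ConstraintFree P = ∀ {r h d} → r ∈ P → (h , d) ∈ occs (head r) → ¬ (h ≡ ⊥e)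

  HeadConsistent : Program A → Set
  HeadConsistent P = ∀ {r₁ r₂ a d₁ d₂} → r₁ ∈ P → r₂ ∈ P
    → (lit (pos a) , d₁) ∈ occs (head r₁) → (lit (neg a) , d₂) ∈ occs (head r₂) → ⊥

  ClosedP : Program A → Interp A → Set
  ClosedP P I = ∀ {r h d} → r ∈ P → (h , d) ∈ occs (head r)
    → sat I (body r) ≡ true → sat I d ≡ false → satE I h ≡ true

  NT : Program A → Interp A → Lit A → Set
  NT P I l = ∃[ r ] ∃[ d ] (r ∈ P × (lit l , d) ∈ occs (head r)
                             × sat I (body r) ≡ true × sat I d ≡ false)

  NN : Program A → SProgram A
  NN P = concatMap (λ r →
           concatMap (λ { (h , d) → map (h ←s_) (dnf (⋀ (body r ∷ dual d ∷ []))) })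
                     (occs (head r)))
         P

  ClosedS : SProgram A → Interp A → Set
  ClosedS Q I = ∀ {r} → r ∈ Q → satAll I (bd r) ≡ true → satE I (hd r) ≡ true

  T : SProgram A → Interp A → Lit A → Set
  T Q I l = ∃[ r ] (r ∈ Q × hd r ≡ lit l × satAll I (bd r) ≡ true)

  IsLeast : (Interp A → Set) → Interp A → Set
  IsLeast Closed I = Closed I × (∀ J → Closed J → I ⊆I J)

  ClosedN : NProgram A → Interp A → Interp A → Set
  ClosedN P I J = ∀ {r} → r ∈ P → sat J (reduct I (nbody r)) ≡ true
                          → sat J (reduct I (nhead r)) ≡ true

  AnswerSet : NProgram A → Interp A → Set
  AnswerSet P I = ClosedN P I I × (∀ J → ClosedN P I J → J ⊆I I → I ⊆I J)

  toNP : Program A → NProgram A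
  toNP = map (λ r → head r ←n body r)

  toNS : SProgram A → NProgram A
  toNS = map (λ r → el (hd r) ←n ⋀ (bd r))

  StronglyEquivalent : NProgram A → NProgram A → Set
  StronglyEquivalent P₁ P₂ = (Q : NProgram A) → (I : Interp A) →
    AnswerSet (P₁ ++ Q) I ⇔ AnswerSet (P₂ ++ Q) I

-- NT_P and T_NN(P) coincide because J ⊨ Δ_B exactly when J =| Δ, and a DNF is equivalent to the
-- formula it is computed from; so P and NN(P) also have the same closed interpretations, which
-- gives (4) and (5). For (6): the reduct by any I leaves not-free rules unchanged, and a head
-- H ∈ ℋ⁺ is equivalent to H_Δ, so J is closed under P^I iff it is closed under P in the NNP sense,
-- iff it is closed under NN(P), iff it is closed under NN(P)^I. Programs with the same closed
-- interpretations under every reduct keep the same answer sets when any Q is added to both.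
{-# OPTIONS --safe #-}
module Submission where

open import Defs

open import Data.Bool using (Bool; true; false; not; _∧_; _∨_)
open import Data.Bool.ListAction using (any)
open import Data.Bool.Properties
  using (T-≡; not-involutive; ∨-assoc; ∨-comm; ∨-identityʳ; ∧-assoc; ∧-identityʳ; ∧-zeroʳ;
         ∧-conicalˡ; ∧-conicalʳ; ∧-distribˡ-∨; ∧-distribʳ-∨; ∨-∧-booleanAlgebra)
open import Algebra.Lattice.Properties.BooleanAlgebra ∨-∧-booleanAlgebra using (deMorgan₁; deMorgan₂)
open import Data.List using (List; []; _∷_; _++_; map; concatMap)
open import Data.List.Properties using (++-assoc; ++-identityʳ)
open import Data.List.Relation.Unary.All using (All; []; _∷_; lookup; tabulate)
open import Data.List.Relation.Unary.All.Properties using (++⁺; ++⁻; map⁺; gmap⁺; gmap⁻)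
open import Data.List.Relation.Unary.Any.Properties using (any⁺; any⁻)
open import Data.List.Membership.Propositional using (_∈_; find; lose)
open import Data.List.Membership.Propositional.Properties
  using (∈-map⁺; ∈-map⁻; ∈-concatMap⁺; ∈-concatMap⁻; ∈-++⁺ˡ; ∈-++⁺ʳ; ∈-++⁻)
open import Data.Product using (_×_; ∃-syntax; _,_; proj₂; map₂; swap)
open import Data.Product.Function.NonDependent.Propositional using (_×-⇔_)
open import Data.Sum using ([_,_]′)
open import Function.Base using (_∘_; _⟨_⟩_)
open import Function.Bundles using (_⇔_; mk⇔; Equivalence)
import Function.Properties.Equivalence as ⇔
open import Function.Related.Propositional using (module EquationalReasoning)
open import Relation.Binary.PropositionalEquality
  using (_≡_; refl; sym; trans; cong; cong₂; module ≡-Reasoning)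
open import Relation.Nullary using (contradiction)

open Equivalence using (to; from)

any≡true⇔∃ : {X : Set} (p : X → Bool) (xs : List X) →
             any p xs ≡ true ⇔ (∃[ x ] (x ∈ xs × p x ≡ true))
any≡true⇔∃ p xs = mk⇔
  (λ s → let x , x∈xs , px = find (any⁻ p xs (from T-≡ s)) in x , x∈xs , to T-≡ px)
  (λ (x , x∈xs , px) → to T-≡ (any⁺ p (lose x∈xs (from T-≡ px))))

any-++ : {X : Set} (p : X → Bool) (xs ys : List X) → any p (xs ++ ys) ≡ any p xs ∨ any p ys
any-++ p []       ys = refl
any-++ p (x ∷ xs) ys = trans (cong (p x ∨_) (any-++ p xs ys)) (sym (∨-assoc (p x) _ _))

∧≡true⇔ : ∀ {x y} → x ∧ y ≡ true ⇔ (x ≡ true × y ≡ true)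
∧≡true⇔ {x} {y} = mk⇔ (λ p → ∧-conicalˡ x y p , ∧-conicalʳ x y p) (λ { (refl , refl) → refl })

module _ {A : Set} where

  satAll-++ : ∀ J (xs ys : List (Expr A)) → satAll J (xs ++ ys) ≡ satAll J xs ∧ satAll J ys
  satAll-++ J []       ys = refl
  satAll-++ J (x ∷ xs) ys =
    trans (cong (sat J x ∧_) (satAll-++ J xs ys)) (sym (∧-assoc (sat J x) _ _))

  satAny-++ : ∀ J (xs ys : List (Expr A)) → satAny J (xs ++ ys) ≡ satAny J xs ∨ satAny J ys
  satAny-++ J []       ys = refl
  satAny-++ J (x ∷ xs) ys =
    trans (cong (sat J x ∨_) (satAny-++ J xs ys)) (sym (∨-assoc (sat J x) _ _))

  -- Duals and disjunctive normal forms

  mutual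
    sat-dual : ∀ J (e : Expr A) → sat J (dual e) ≡ not (sat J e)
    sat-dual J (el (lit l)) = refl
    sat-dual J (el (nt l))  = refl
    sat-dual J (el ⊤e)      = refl
    sat-dual J (el ⊥e)      = refl
    sat-dual J (ov x)       = sym (not-involutive (satE J x))
    sat-dual J (⋀ es)       = satAny-dualL J es
    sat-dual J (⋁ es)       = satAll-dualL J es

    satAny-dualL : ∀ J (es : List (Expr A)) → satAny J (dualL es) ≡ not (satAll J es)
    satAny-dualL J []       = refl
    satAny-dualL J (e ∷ es) =
      trans (cong₂ _∨_ (sat-dual J e) (satAny-dualL J es)) (sym (deMorgan₁ (sat J e) _))

    satAll-dualL : ∀ J (es : List (Expr A)) → satAll J (dualL es) ≡ not (satAny J es)
    satAll-dualL J []       = refl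
    satAll-dualL J (e ∷ es) =
      trans (cong₂ _∧_ (sat-dual J e) (satAll-dualL J es)) (sym (deMorgan₂ (sat J e) _))

  sat-body-dual⇔ : ∀ J (b d : Expr A) →
                   sat J (⋀ (b ∷ dual d ∷ [])) ≡ true ⇔ (sat J b ≡ true × sat J d ≡ false)
  sat-body-dual⇔ J b d rewrite sat-dual J d with sat J b | sat J d
  ... | true  | false = mk⇔ (λ _ → refl , refl) (λ _ → refl)
  ... | true  | true  = mk⇔ (λ ()) (λ { (_ , ()) })
  ... | false | _     = mk⇔ (λ ()) (λ { (() , _) })

  any-satAll-map-++ : ∀ J (c : List (Expr A)) ds →
                      any (satAll J) (map (c ++_) ds) ≡ satAll J c ∧ any (satAll J) ds
  any-satAll-map-++ J c []       = sym (∧-zeroʳ (satAll J c))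
  any-satAll-map-++ J c (d ∷ ds) = begin
    satAll J (c ++ d) ∨ any (satAll J) (map (c ++_) ds)
      ≡⟨ cong₂ _∨_ (satAll-++ J c d) (any-satAll-map-++ J c ds) ⟩
    satAll J c ∧ satAll J d ∨ satAll J c ∧ any (satAll J) ds
      ≡⟨ ∧-distribˡ-∨ (satAll J c) _ _ ⟨
    satAll J c ∧ (satAll J d ∨ any (satAll J) ds) ∎
    where open ≡-Reasoning

  any-satAll-cross : ∀ J (cs ds : List (List (Expr A))) →
                     any (satAll J) (cross cs ds) ≡ any (satAll J) cs ∧ any (satAll J) ds
  any-satAll-cross J []       ds = refl
  any-satAll-cross J (c ∷ cs) ds = begin
    any (satAll J) (map (c ++_) ds ++ cross cs ds)
      ≡⟨ any-++ (satAll J) (map (c ++_) ds) _ ⟩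
    any (satAll J) (map (c ++_) ds) ∨ any (satAll J) (cross cs ds)
      ≡⟨ cong₂ _∨_ (any-satAll-map-++ J c ds) (any-satAll-cross J cs ds) ⟩
    satAll J c ∧ any (satAll J) ds ∨ any (satAll J) cs ∧ any (satAll J) ds
      ≡⟨ ∧-distribʳ-∨ (any (satAll J) ds) (satAll J c) _ ⟨
    (satAll J c ∨ any (satAll J) cs) ∧ any (satAll J) ds ∎
    where open ≡-Reasoning

  mutual
    sat-dnf : ∀ J (e : Expr A) → sat J e ≡ any (satAll J) (dnf e)
    sat-dnf J (el x) = sym (trans (∨-identityʳ _) (∧-identityʳ _))
    sat-dnf J (ov x) = sym (trans (∨-identityʳ _) (∧-identityʳ _))
    sat-dnf J (⋀ es) = satAll-dnfAnd J es
    sat-dnf J (⋁ es) = satAny-dnfOr J es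

    satAll-dnfAnd : ∀ J (es : List (Expr A)) → satAll J es ≡ any (satAll J) (dnfAnd es)
    satAll-dnfAnd J []       = refl
    satAll-dnfAnd J (e ∷ es) = trans (cong₂ _∧_ (sat-dnf J e) (satAll-dnfAnd J es))
                                     (sym (any-satAll-cross J (dnf e) (dnfAnd es)))

    satAny-dnfOr : ∀ J (es : List (Expr A)) → satAny J es ≡ any (satAll J) (dnfOr es)
    satAny-dnfOr J []       = refl
    satAny-dnfOr J (e ∷ es) = trans (cong₂ _∨_ (sat-dnf J e) (satAny-dnfOr J es))
                                    (sym (any-++ (satAll J) (dnf e) (dnfOr es)))

  sat⇔dnf-disjunct : ∀ J (e : Expr A) → sat J e ≡ true ⇔ (∃[ C ] (C ∈ dnf e × satAll J C ≡ true))
  sat⇔dnf-disjunct J e rewrite sat-dnf J e = any≡true⇔∃ (satAll J) (dnf e)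

  bodyΔ : Rule A → Expr A → Expr A
  bodyΔ r d = ⋀ (body r ∷ dual d ∷ [])

  NN-occ : Rule A → Elem A × Expr A → SProgram A
  NN-occ r (h , d) = map (h ←s_) (dnf (bodyΔ r d))

  NN-rule : Rule A → SProgram A
  NN-rule r = concatMap (NN-occ r) (occs (head r))

  ∈-NN⁺ : ∀ {P r h d C} → r ∈ P → (h , d) ∈ occs (head r) → C ∈ dnf (bodyΔ r d) → (h ←s C) ∈ NN P
  ∈-NN⁺ {r = r} {h} r∈P hd∈ C∈ =
    ∈-concatMap⁺ NN-rule (lose r∈P (∈-concatMap⁺ (NN-occ r) (lose hd∈ (∈-map⁺ (h ←s_) C∈))))

  ∈-NN⁻ : ∀ {P h C} → (h ←s C) ∈ NN P →
          ∃[ r ] ∃[ d ] (r ∈ P × (h , d) ∈ occs (head r) × C ∈ dnf (bodyΔ r d))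
  ∈-NN⁻ hC∈ with find (∈-concatMap⁻ NN-rule hC∈)
  ... | r , r∈P , hC∈′ with find (∈-concatMap⁻ (NN-occ r) hC∈′)
  ... | (h , d) , hd∈ , hC∈″ with ∈-map⁻ (h ←s_) hC∈″
  ... | C , C∈ , refl = r , d , r∈P , hd∈ , C∈

  Fires : Program A → Interp A → Elem A → Set
  Fires P J h =
    ∃[ r ] ∃[ d ] (r ∈ P × (h , d) ∈ occs (head r) × sat J (body r) ≡ true × sat J d ≡ false)

  FiresS : SProgram A → Interp A → Elem A → Set
  FiresS Q J h = ∃[ C ] ((h ←s C) ∈ Q × satAll J C ≡ true)

  fires⇔fires-NN : ∀ {P J h} → Fires P J h ⇔ FiresS (NN P) J h
  fires⇔fires-NN {J = J} = mk⇔
    (λ (r , d , r∈P , hd∈ , fired) →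
       let C , C∈ , sC = to (fired⇔dnf r d) fired in C , ∈-NN⁺ r∈P hd∈ C∈ , sC)
    (λ (C , hC∈ , sC) →
       let r , d , r∈P , hd∈ , C∈ = ∈-NN⁻ hC∈ in r , d , r∈P , hd∈ , from (fired⇔dnf r d) (C , C∈ , sC))
    where
    fired⇔dnf : ∀ r d → (sat J (body r) ≡ true × sat J d ≡ false) ⇔
                        (∃[ C ] (C ∈ dnf (bodyΔ r d) × satAll J C ≡ true))
    fired⇔dnf r d = ⇔.sym (sat-body-dual⇔ J (body r) d) ⟨ ⇔.trans ⟩ sat⇔dnf-disjunct J (bodyΔ r d)

  closedP⇔closedS-NN : ∀ {P J} → ClosedP P J ⇔ ClosedS (NN P) J
  closedP⇔closedS-NN {P} {J} = mk⇔ to′ from′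
    where
    to′ : ClosedP P J → ClosedS (NN P) J
    to′ closed hC∈ sC =
      let _ , _ , r∈P , hd∈ , sb , sd = from fires⇔fires-NN (_ , hC∈ , sC) in closed r∈P hd∈ sb sd

    from′ : ClosedS (NN P) J → ClosedP P J
    from′ closed r∈P hd∈ sb sd =
      let _ , hC∈ , sC = to fires⇔fires-NN (_ , _ , r∈P , hd∈ , sb , sd) in closed hC∈ sC

  NT⇔T-NN : ∀ {P I l} → NT P I l ⇔ T (NN P) I l
  NT⇔T-NN = mk⇔
    (λ fires → let C , hC∈ , sC = to fires⇔fires-NN fires in _ , hC∈ , refl , sC)
    (λ { ((_ ←s C) , hC∈ , refl , sC) → from fires⇔fires-NN (C , hC∈ , sC) })

  isLeast-cong : ∀ {C₁ C₂ : Interp A → Set} {I} → (∀ J → C₁ J ⇔ C₂ J) →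
                 IsLeast C₁ I ⇔ IsLeast C₂ I
  isLeast-cong C₁⇔C₂ = mk⇔ (transfer C₁⇔C₂) (transfer (⇔.sym ∘ C₁⇔C₂))
    where
    transfer : ∀ {C₁ C₂ : Interp A → Set} {I} → (∀ J → C₁ J ⇔ C₂ J) → IsLeast C₁ I → IsLeast C₂ I
    transfer C₁⇔C₂ (closed , least) =
      to (C₁⇔C₂ _) closed , λ J closedJ → least J (from (C₁⇔C₂ J) closedJ)

  -- ℋ⁺ and H_Δ

  mutual
    occs-N : ∀ {e : Expr A} → InN e → occs e ≡ []
    occs-N (ov x) = refl
    occs-N (⋀ ns) = occsAnd-N ns
    occs-N (⋁ ns) = occsOr-N ns

    occsAnd-N : ∀ {es : List (Expr A)} → All InN es → occsAnd es ≡ []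
    occsAnd-N []       = refl
    occsAnd-N (n ∷ ns) rewrite occs-N n = occsAnd-N ns

    occsOr-N : ∀ {pre es : List (Expr A)} → All InN es → occsOr pre es ≡ []
    occsOr-N []       = refl
    occsOr-N (n ∷ ns) rewrite occs-N n = occsOr-N ns

  occsOr-skipN : ∀ {pre xs : List (Expr A)} ys → All InN xs →
                 occsOr pre (xs ++ ys) ≡ occsOr (pre ++ xs) ys
  occsOr-skipN {pre} ys [] = cong (λ p → occsOr p ys) (sym (++-identityʳ pre))
  occsOr-skipN {pre} {x ∷ xs} ys (n ∷ ns) rewrite occs-N n =
    trans (occsOr-skipN ys ns) (cong (λ p → occsOr p ys) (++-assoc pre (x ∷ []) xs))

  occs-⋁ : ∀ {pre post : List (Expr A)} {e} → All InN pre → All InN post →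
           occs (⋁ (pre ++ e ∷ post)) ≡ map (map₂ (λ d → ⋁ (pre ++ d ∷ post))) (occs e)
  occs-⋁ {pre} {post} {e} npre npost = begin
    occsOr [] (pre ++ e ∷ post)
      ≡⟨ occsOr-skipN (e ∷ post) npre ⟩
    map (map₂ (λ d → ⋁ (pre ++ d ∷ post))) (occs e) ++ occsOr (pre ++ e ∷ []) post
      ≡⟨ cong (map (map₂ (λ d → ⋁ (pre ++ d ∷ post))) (occs e) ++_) (occsOr-N npost) ⟩
    map (map₂ (λ d → ⋁ (pre ++ d ∷ post))) (occs e) ++ []
      ≡⟨ ++-identityʳ _ ⟩
    map (map₂ (λ d → ⋁ (pre ++ d ∷ post))) (occs e) ∎
    where open ≡-Reasoning

  sat-⋁-around : ∀ J (pre post : List (Expr A)) x →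
                 sat J (⋁ (pre ++ x ∷ post)) ≡ satAny J (pre ++ post) ∨ sat J x
  sat-⋁-around J pre post x = begin
    satAny J (pre ++ x ∷ post)                   ≡⟨ satAny-++ J pre (x ∷ post) ⟩
    satAny J pre ∨ (sat J x ∨ satAny J post)     ≡⟨ cong (satAny J pre ∨_) (∨-comm (sat J x) _) ⟩
    satAny J pre ∨ (satAny J post ∨ sat J x)     ≡⟨ ∨-assoc (satAny J pre) _ _ ⟨
    (satAny J pre ∨ satAny J post) ∨ sat J x     ≡⟨ cong (_∨ sat J x) (satAny-++ J pre post) ⟨
    satAny J (pre ++ post) ∨ sat J x             ∎
    where open ≡-Reasoning

  -- J ⊨ ⋁(h Δ), the conjunct of H_Δ for the occurrence (h , Δ)
  Sat⋁hΔ : Interp A → Elem A × Expr A → Set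
  Sat⋁hΔ J (h , d) = sat J d ≡ false → satE J h ≡ true

  -- f plays the context ⋁(pre ++ _ ∷ post), pre, post ∈ 𝒩, whose other disjuncts contribute o.
  sat⇔Sat⋁hΔ-∨context : ∀ J {e} o (f : Expr A → Expr A) → (∀ x → sat J (f x) ≡ o ∨ sat J x) →
                        sat J e ≡ true ⇔ All (Sat⋁hΔ J) (occs e) →
                        sat J (f e) ≡ true ⇔ All (Sat⋁hΔ J) (map (map₂ f) (occs e))
  sat⇔Sat⋁hΔ-∨context J true  f f≡ _ = mk⇔
    (λ _ → map⁺ (tabulate λ _ fd≡false → contradiction (trans (sym (f≡ _)) fd≡false) λ ()))
    (λ _ → f≡ _)
  sat⇔Sat⋁hΔ-∨context J false f f≡ e⇔ = mk⇔
    (λ s → gmap⁺ (λ sat⋁ fd≡false → sat⋁ (trans (sym (f≡ _)) fd≡false)) (to e⇔ (trans (sym (f≡ _)) s)))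
    (λ sats → trans (f≡ _) (from e⇔ (gmap⁻ (λ sat⋁ d≡false → sat⋁ (trans (f≡ _) d≡false)) sats)))

  mutual
    sat⇔Sat⋁hΔ : ∀ J {H : Expr A} → InH+ H → sat J H ≡ true ⇔ All (Sat⋁hΔ J) (occs H)
    sat⇔Sat⋁hΔ J (lit l) = mk⇔ (λ s → (λ _ → s) ∷ []) (λ { (s ∷ []) → s refl })
    sat⇔Sat⋁hΔ J ⊥e      = mk⇔ (λ ()) (λ { (s ∷ []) → s refl })
    sat⇔Sat⋁hΔ J (⋀ hs)  = satAll⇔Sat⋁hΔ J hs
    sat⇔Sat⋁hΔ J (⋁ {pre} {post} {e} npre he npost) rewrite occs-⋁ {e = e} npre npost =
      sat⇔Sat⋁hΔ-∨context J (satAny J (pre ++ post)) (λ x → ⋁ (pre ++ x ∷ post))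
        (sat-⋁-around J pre post) (sat⇔Sat⋁hΔ J he)

    satAll⇔Sat⋁hΔ : ∀ J {Hs : List (Expr A)} → All InH+ Hs →
                    satAll J Hs ≡ true ⇔ All (Sat⋁hΔ J) (occsAnd Hs)
    satAll⇔Sat⋁hΔ J []       = mk⇔ (λ _ → []) (λ _ → refl)
    satAll⇔Sat⋁hΔ J {H ∷ _} (h ∷ hs) =
      ∧≡true⇔ ⟨ ⇔.trans ⟩ (sat⇔Sat⋁hΔ J h ×-⇔ satAll⇔Sat⋁hΔ J hs)
              ⟨ ⇔.trans ⟩ mk⇔ (λ (p , q) → ++⁺ p q) (++⁻ (occs H))

  -- Not-free expressions and reducts

  reductE-notFree : ∀ {I} {x : Elem A} → NotFreeE x → reductE I x ≡ x
  reductE-notFree (lit l) = refl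
  reductE-notFree ⊤e      = refl
  reductE-notFree ⊥e      = refl

  mutual
    reduct-notFree : ∀ {I} {e : Expr A} → NotFree e → reduct I e ≡ e
    reduct-notFree (el n) = cong el (reductE-notFree n)
    reduct-notFree (ov n) = cong ov (reductE-notFree n)
    reduct-notFree (⋀ ns) = cong ⋀ (reductL-notFree ns)
    reduct-notFree (⋁ ns) = cong ⋁ (reductL-notFree ns)

    reductL-notFree : ∀ {I} {es : List (Expr A)} → All NotFree es → reductL I es ≡ es
    reductL-notFree []       = refl
    reductL-notFree (n ∷ ns) = cong₂ _∷_ (reduct-notFree n) (reductL-notFree ns)

  mutual
    dual-notFree : ∀ {e : Expr A} → NotFree e → NotFree (dual e)
    dual-notFree (el (lit l)) = ov (lit l)
    dual-notFree (el ⊤e)      = ov ⊤e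
    dual-notFree (el ⊥e)      = el ⊤e
    dual-notFree (ov n)       = el n
    dual-notFree (⋀ ns)       = ⋁ (dualL-notFree ns)
    dual-notFree (⋁ ns)       = ⋀ (dualL-notFree ns)

    dualL-notFree : ∀ {es : List (Expr A)} → All NotFree es → All NotFree (dualL es)
    dualL-notFree []       = []
    dualL-notFree (n ∷ ns) = dual-notFree n ∷ dualL-notFree ns

  All-cross : ∀ {Q : Expr A → Set} {cs ds} → All (All Q) cs → All (All Q) ds →
              All (All Q) (cross cs ds)
  All-cross []         _   = []
  All-cross (qc ∷ qcs) qds = ++⁺ (gmap⁺ (++⁺ qc) qds) (All-cross qcs qds)

  mutual
    dnf-notFree : ∀ {e : Expr A} → NotFree e → All (All NotFree) (dnf e)
    dnf-notFree (el n) = (el n ∷ []) ∷ []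
    dnf-notFree (ov n) = (ov n ∷ []) ∷ []
    dnf-notFree (⋀ ns) = dnfAnd-notFree ns
    dnf-notFree (⋁ ns) = dnfOr-notFree ns

    dnfAnd-notFree : ∀ {es : List (Expr A)} → All NotFree es → All (All NotFree) (dnfAnd es)
    dnfAnd-notFree []       = [] ∷ []
    dnfAnd-notFree (n ∷ ns) = All-cross (dnf-notFree n) (dnfAnd-notFree ns)

    dnfOr-notFree : ∀ {es : List (Expr A)} → All NotFree es → All (All NotFree) (dnfOr es)
    dnfOr-notFree []       = []
    dnfOr-notFree (n ∷ ns) = ++⁺ (dnf-notFree n) (dnfOr-notFree ns)

  NotFreeOcc : Elem A × Expr A → Set
  NotFreeOcc (h , d) = NotFreeE h × NotFree d

  mutual
    occs-notFree : ∀ {H : Expr A} → NotFree H → All NotFreeOcc (occs H)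
    occs-notFree (el n) = (n , el ⊥e) ∷ []
    occs-notFree (ov n) = []
    occs-notFree (⋀ ns) = occsAnd-notFree ns
    occs-notFree (⋁ ns) = occsOr-notFree [] ns

    occsAnd-notFree : ∀ {Hs : List (Expr A)} → All NotFree Hs → All NotFreeOcc (occsAnd Hs)
    occsAnd-notFree []       = []
    occsAnd-notFree (n ∷ ns) = ++⁺ (occs-notFree n) (occsAnd-notFree ns)

    occsOr-notFree : ∀ {pre Hs : List (Expr A)} → All NotFree pre → All NotFree Hs →
                     All NotFreeOcc (occsOr pre Hs)
    occsOr-notFree npre []       = []
    occsOr-notFree npre (n ∷ ns) =
      ++⁺ (gmap⁺ (map₂ (λ nd → ⋁ (++⁺ npre (nd ∷ ns)))) (occs-notFree n))
          (occsOr-notFree (++⁺ npre (n ∷ [])) ns)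

  NN-notFree : ∀ {P h C} → NotFreeP P → (h ←s C) ∈ NN P → NotFreeE h × All NotFree C
  NN-notFree nfP hC∈ =
    let r , d , r∈P , hd∈ , C∈ = ∈-NN⁻ hC∈
        nb , nH = nfP r∈P
        nh , nd = lookup (occs-notFree nH) hd∈
    in nh , lookup (dnf-notFree {bodyΔ r d} (⋀ (nb ∷ dual-notFree nd ∷ []))) C∈

  -- Nested programs and strong equivalence

  NotFreeN : NProgram A → Set
  NotFreeN Q = ∀ {r} → r ∈ Q → NotFree (nhead r) × NotFree (nbody r)

  ModelN : NProgram A → Interp A → Set
  ModelN Q J = ∀ {r} → r ∈ Q → sat J (nbody r) ≡ true → sat J (nhead r) ≡ true

  closedN⇔modelN : ∀ {Q : NProgram A} {I J} → NotFreeN Q → ClosedN Q I J ⇔ ModelN Q J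
  closedN⇔modelN {I = I} {J} nfQ = mk⇔
    (λ closed {_} r∈Q s → let nH , nB = nfQ r∈Q in
       trans (sym (sat-reduct nH)) (closed r∈Q (trans (sat-reduct nB) s)))
    (λ model {_} r∈Q s → let nH , nB = nfQ r∈Q in
       trans (sat-reduct nH) (model r∈Q (trans (sym (sat-reduct nB)) s)))
    where
    sat-reduct : ∀ {e} → NotFree e → sat J (reduct I e) ≡ sat J e
    sat-reduct n = cong (sat J) (reduct-notFree n)

  toNP-notFree : ∀ {P} → NotFreeP P → NotFreeN (toNP P)
  toNP-notFree nfP r∈ with ∈-map⁻ _ r∈
  ... | _ , r∈P , refl = swap (nfP r∈P)

  toNS-NN-notFree : ∀ {P} → NotFreeP P → NotFreeN (toNS (NN P))
  toNS-NN-notFree nfP r∈ with ∈-map⁻ _ r∈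
  ... | _ , r∈NN , refl = let nh , nC = NN-notFree nfP r∈NN in el nh , ⋀ nC

  modelN-toNP⇔closedP : ∀ {P J} → (∀ {r} → r ∈ P → InH+ (head r)) →
                        ModelN (toNP P) J ⇔ ClosedP P J
  modelN-toNP⇔closedP {P} {J} H⁺ = mk⇔ to′ from′
    where
    to′ : ModelN (toNP P) J → ClosedP P J
    to′ model r∈P hd∈ sb sd =
      lookup (to (sat⇔Sat⋁hΔ J (H⁺ r∈P)) (model (∈-map⁺ _ r∈P) sb)) hd∈ sd

    from′ : ClosedP P J → ModelN (toNP P) J
    from′ closed r∈ s with ∈-map⁻ _ r∈
    ... | _ , r∈P , refl =
      from (sat⇔Sat⋁hΔ J (H⁺ r∈P)) (tabulate λ hd∈ sd → closed r∈P hd∈ s sd)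

  modelN-toNS⇔closedS : ∀ {Q : SProgram A} {J} → ModelN (toNS Q) J ⇔ ClosedS Q J
  modelN-toNS⇔closedS {Q} {J} = mk⇔ (λ model {_} r∈Q → model (∈-map⁺ _ r∈Q)) from′
    where
    from′ : ClosedS Q J → ModelN (toNS Q) J
    from′ closed r∈ with ∈-map⁻ _ r∈
    ... | _ , r∈Q , refl = closed r∈Q

  closedN-++⇔ : ∀ {P Q : NProgram A} {I J} →
                ClosedN (P ++ Q) I J ⇔ (ClosedN P I J × ClosedN Q I J)
  closedN-++⇔ {P} {Q} {I} {J} = mk⇔ split join
    where
    split : ClosedN (P ++ Q) I J → ClosedN P I J × ClosedN Q I J
    split closed = (λ r∈P → closed (∈-++⁺ˡ r∈P)) , (λ r∈Q → closed (∈-++⁺ʳ P r∈Q))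

    join : ClosedN P I J × ClosedN Q I J → ClosedN (P ++ Q) I J
    join (closedP , closedQ) r∈ = [ closedP , closedQ ]′ (∈-++⁻ P r∈)

  answerSet-cong : ∀ {P₁ P₂ : NProgram A} {I} → (∀ J → ClosedN P₁ I J ⇔ ClosedN P₂ I J) →
                   AnswerSet P₁ I ⇔ AnswerSet P₂ I
  answerSet-cong P₁⇔P₂ = mk⇔ (transfer P₁⇔P₂) (transfer (⇔.sym ∘ P₁⇔P₂))
    where
    transfer : ∀ {P₁ P₂ : NProgram A} {I} → (∀ J → ClosedN P₁ I J ⇔ ClosedN P₂ I J) →
               AnswerSet P₁ I → AnswerSet P₂ I
    transfer P₁⇔P₂ (closed , minimal) =
      to (P₁⇔P₂ _) closed , λ J closedJ J⊆I → minimal J (from (P₁⇔P₂ J) closedJ) J⊆I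

  stronglyEquivalent-by-closedN : ∀ {P₁ P₂ : NProgram A} → (∀ I J → ClosedN P₁ I J ⇔ ClosedN P₂ I J) →
                                  StronglyEquivalent P₁ P₂
  stronglyEquivalent-by-closedN P₁⇔P₂ Q I = answerSet-cong λ J →
    closedN-++⇔ ⟨ ⇔.trans ⟩ (P₁⇔P₂ I J ×-⇔ ⇔.refl) ⟨ ⇔.trans ⟩ ⇔.sym closedN-++⇔

  closedN-toNP⇔closedN-toNS-NN : ∀ {P I J} → IsNNP P → NotFreeP P →
                                 ClosedN (toNP P) I J ⇔ ClosedN (toNS (NN P)) I J
  closedN-toNP⇔closedN-toNS-NN {P} {I} {J} (_ , nnp) nfP = begin
    ClosedN (toNP P) I J       ∼⟨ closedN⇔modelN (toNP-notFree nfP) ⟩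
    ModelN (toNP P) J          ∼⟨ modelN-toNP⇔closedP (λ r∈P → proj₂ (nnp r∈P)) ⟩
    ClosedP P J                ∼⟨ closedP⇔closedS-NN ⟩
    ClosedS (NN P) J           ∼⟨ ⇔.sym modelN-toNS⇔closedS ⟩
    ModelN (toNS (NN P)) J     ∼⟨ ⇔.sym (closedN⇔modelN (toNS-NN-notFree nfP)) ⟩
    ClosedN (toNS (NN P)) I J  ∎
    where open EquationalReasoning

-- Constraint-freeness and head-consistency are what make Cn(P) exist as an interpretation;
-- IsLeast only characterises Cn.
proposition27 : {A : Set} (P : Program A) → IsNNP P → NotFreeP P → ConstraintFree P → HeadConsistent P
    → ((I : Interp A) → IsLeast (ClosedP P) I ⇔ IsLeast (ClosedS (NN P)) I)
      × ((I : Interp A) (l : Lit A) → NT P I l ⇔ T (NN P) I l)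
      × StronglyEquivalent (toNP P) (toNS (NN P))
proposition27 P nnp nfP _ _ =
    (λ I → isLeast-cong λ J → closedP⇔closedS-NN)
  , (λ I l → NT⇔T-NN)
  , stronglyEquivalent-by-closedN λ I J → closedN-toNP⇔closedN-toNS-NN nnp nfP
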